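{- For every prime power $q$, the graph $G(q^2,q+1)$ is $K_{3,3}$-free.
   Context: For a prime power $Q$ and a positive integer $t$ with $t\mid Q-1$, let $\mathbf{F}=\mathrm{GF}(Q)$ and let $H\subseteq\mathbf{F}^\ast$ be the (unique) subgroup of the multiplicative group of order $t$. The graph $G(Q,t)$ has vertex set $(\mathbf{F}\times\mathbf{F}\setminus\{(0,0)\})/\sim$, where $(a_1,b_1)\sim(a_2,b_2)$ iff there is $h\in H$ with $a_1=ha_2$ and $b_1=hb_2$; write $\langle a,b\rangle$ for the class of $(a,b)$. Two distinct vertices $\langle a,b\rangle$ and $\langle x,y\rangle$ are adjacent iff $ax+by\in H$ (this is well defined; the graph is simple, without loops). A graph is $K_{s,t}$-free if it contains no (not necessarily induced) subgraph isomorphic to the complete bipartite graph $K_{s,t}$. -}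

module Defs where

open import Level using (0ℓ)
open import Data.Nat using (ℕ; _≥_; _^_)
open import Data.Nat.Primality using (Prime)
open import Data.Fin using (Fin)
open import Data.List using (List; length)
open import Data.List.Membership.Propositional using (_∈_)
open import Data.List.Relation.Unary.Unique.Propositional using (Unique)
open import Data.Product using (Σ; ∃; _×_; _,_)
open import Relation.Nullary using (¬_)
open import Relation.Binary.PropositionalEquality using (_≡_; _≢_)
open import Algebra.Core using (Op₁; Op₂)
open import Algebra.Structures using (IsCommutativeRing)
open import Function.Bundles using (_⇔_)

IsPrimePower : ℕ → Set
IsPrimePower q = Σ ℕ λ p → Σ ℕ λ k → Prime p × k ≥ 1 × q ≡ p ^ k

record Field : Set₁ where
  infixl 7 _*_
  infixl 6 _+_
  field
    Carrier : Set
    _+_ _*_ : Op₂ Carrier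
    -_      : Op₁ Carrier
    0# 1#   : Carrier
    isCommutativeRing : IsCommutativeRing _≡_ _+_ _*_ -_ 0# 1#
    0≢1     : 0# ≢ 1#
    inverse : ∀ x → x ≢ 0# → ∃ λ y → x * y ≡ 1#

module _ (F : Field) where
  open Field F

  record IsMulSubgroupOfOrder (H : Carrier → Set) (t : ℕ) : Set where
    field
      nonzero  : ∀ x → H x → x ≢ 0#
      one∈     : H 1#
      mul∈     : ∀ x y → H x → H y → H (x * y)
      inv∈     : ∀ x → H x → ∃ λ y → H y × x * y ≡ 1#
      elements : List Carrier
      elemsUnique : Unique elements
      elemsLength : length elements ≡ t
      elemsSpec   : ∀ x → H x ⇔ (x ∈ elements)

  -- Graph G(F, H): vertices are classes <a,b> of nonzero pairs modulo H-scaling.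
  -- Since Agda has no quotients, a vertex is represented by a nonzero pair,
  -- and equality of vertices (classes) is the relation _∼_.
  Vertex : Set
  Vertex = Σ (Carrier × Carrier) λ { (a , b) → ¬ (a ≡ 0# × b ≡ 0#) }

  module Graph (H : Carrier → Set) where

    _∼_ : Vertex → Vertex → Set
    ((a₁ , b₁) , _) ∼ ((a₂ , b₂) , _) =
      Σ Carrier λ h → H h × a₁ ≡ h * a₂ × b₁ ≡ h * b₂

    Adj : Vertex → Vertex → Set
    Adj u@((a , b) , _) v@((x , y) , _) = ¬ (u ∼ v) × H (a * x + b * y)

    -- contains K_{3,3} as a (not necessarily induced) subgraph:
    -- six pairwise distinct vertices A₁,A₂,A₃,B₁,B₂,B₃ with every Aᵢ adjacent to every Bⱼ
    -- (Aᵢ ≠ Bⱼ is implied by adjacency).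
    ContainsK33 : Set
    ContainsK33 =
      Σ (Fin 3 → Vertex) λ A → Σ (Fin 3 → Vertex) λ B →
        (∀ i j → i ≢ j → ¬ (A i ∼ A j)) ×
        (∀ i j → i ≢ j → ¬ (B i ∼ B j)) ×
        (∀ i j → Adj (A i) (B j))

    K33Free : Set
    K33Free = ¬ ContainsK33

-- Let σ be the Frobenius x ↦ x^q of F = GF(q²). It is additive, and h σ(h) = h^(q+1) = 1 for every h in H,
-- the subgroup of order q + 1. Suppose A₁, A₂, A₃ and B₁, B₂, B₃ span a K₃,₃, so that every Aᵢ ∙ Bⱼ lies in H.
-- Two B's adjacent to A₁ are proportional only if they are the same vertex, so by Cramer's rule
-- det(B₁,B₂) (a ∙ B₃) = det(B₃,B₂) (a ∙ B₁) + det(B₁,B₃) (a ∙ B₂) with nonzero coefficients. Dividing row i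
-- by Aᵢ ∙ B₁ gives hᵢ = (Aᵢ ∙ B₂)/(Aᵢ ∙ B₁) ∈ H and c + d hᵢ ∈ H for constants c, d ≠ 0, and the hᵢ are
-- distinct because the Aᵢ are. But c + d h ∈ H means (c + d h) σ(c + d h) h = h, a quadratic equation in h
-- with leading coefficient d σ(c) ≠ 0, which cannot have three roots.

module Submission where

open import Defs
open import Level using (0ℓ)
open import Algebra.Bundles using (CommutativeMonoid; CommutativeRing; CommutativeSemiring)
open import Algebra.Core using (Op₂)
open import Algebra.Structures using (IsCommutativeMonoid)
open import Data.Nat as ℕ using (ℕ; zero; suc; _!; _∸_; z≤n; s≤s)
open import Data.Nat.Properties as ℕ using ()
open import Data.Nat.Divisibility using (_∣_; divides; ∣⇒≤; ∣1⇒≡1; m∣m*n)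
open import Data.Nat.DivMod using (m*[n/m]≡n)
open import Data.Nat.Combinatorics using (_C_; k![n∸k]!∣n!; nCn≡1)
open import Data.Nat.Combinatorics.Specification using (nCk≡n!/k![n-k]!)
open import Data.Nat.Primality using (Prime; euclidsLemma; prime⇒nonTrivial)
open import Data.Fin as Fin using (Fin; toℕ; inject₁; fromℕ)
open import Data.Fin.Patterns using (0F; 1F; 2F)
open import Data.Fin.Properties using (toℕ-fromℕ; toℕ-inject₁; toℕ<n; inj⇒≟)
open import Data.List using (List; []; _∷_; _++_; [_]; length; map; foldr; allFin)
open import Data.List.Properties using (length-++; length-map; length-tabulate)
open import Data.List.Membership.Propositional using (_∈_)
open import Data.List.Membership.Propositional.Properties
  using (∈-∃++; ∈-++⁻; ∈-++⁺ˡ; ∈-++⁺ʳ; ∈-map⁺; ∈-map⁻; ∈-allFin)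
open import Data.List.Relation.Binary.Subset.Propositional using (_⊆_)
open import Data.List.Relation.Binary.Permutation.Propositional using (_↭_; prep; ↭-refl; ↭-sym; ↭-trans; ↭⇒↭ₛ)
open import Data.List.Relation.Binary.Permutation.Propositional.Properties using (shift)
import Data.List.Relation.Binary.Permutation.Setoid.Properties as ↭ₛ
open import Data.List.Relation.Unary.Any using (here; there)
open import Data.List.Relation.Unary.All using (lookup)
open import Data.List.Relation.Unary.AllPairs using (_∷_)
open import Data.List.Relation.Unary.Unique.Propositional using (Unique)
import Data.List.Relation.Unary.Unique.Propositional.Properties as Unique
open import Data.Product using (∃; _×_; _,_; proj₁; proj₂)
open import Data.Sum using (inj₁; inj₂)
open import Data.Empty using (⊥; ⊥-elim)
open import Function.Base using (_∘_)
open import Function.Bundles using (_↔_; Inverse; Equivalence)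
open import Function.Properties.Inverse using (↔⇒↣)
open import Relation.Nullary using (¬_; Dec; yes; no)
open import Relation.Binary.PropositionalEquality
  using (_≡_; _≢_; refl; sym; trans; cong; cong₂; subst; setoid; module ≡-Reasoning)

module _ {A : Set} where

  ⊆-Unique-length⇒↭ : ∀ {xs ys : List A} → Unique xs → xs ⊆ ys → length xs ≡ length ys → xs ↭ ys
  ⊆-Unique-length⇒↭ {[]}     {[]}    _          _     _   = ↭-refl
  ⊆-Unique-length⇒↭ {[]}     {_ ∷ _} _          _     ()
  ⊆-Unique-length⇒↭ {x ∷ xs} {ys}    (x∉xs ∷ u) xs⊆ys len with ∈-∃++ (xs⊆ys (here refl))
  ... | zs , ws , refl =
    ↭-trans (prep x (⊆-Unique-length⇒↭ u xs⊆zs++ws (ℕ.suc-injective len′))) (↭-sym (shift x zs ws))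
    where
    xs⊆zs++ws : xs ⊆ zs ++ ws
    xs⊆zs++ws {y} y∈xs with ∈-++⁻ zs (xs⊆ys (there y∈xs))
    ... | inj₁ y∈zs         = ∈-++⁺ˡ y∈zs
    ... | inj₂ (here y≡x)   = ⊥-elim (lookup x∉xs y∈xs (sym y≡x))
    ... | inj₂ (there y∈ws) = ∈-++⁺ʳ zs y∈ws
    len′ : suc (length xs) ≡ suc (length (zs ++ ws))
    len′ = trans len (trans (length-++ zs) (trans (ℕ.+-suc (length zs) (length ws)) (cong suc (sym (length-++ zs)))))

module _ {A : Set} {_∙_ : Op₂ A} {ε : A} (isCommutativeMonoid : IsCommutativeMonoid _≡_ _∙_ ε) where

  private
    monoid : CommutativeMonoid 0ℓ 0ℓ
    monoid = record { isCommutativeMonoid = isCommutativeMonoid }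

  open import Algebra.Definitions.RawMonoid (CommutativeMonoid.rawMonoid monoid) renaming (_×_ to _·_)
  open import Algebra.Properties.CommutativeSemigroup (CommutativeMonoid.commutativeSemigroup monoid)
    using (interchange)

  foldr-map-∙ˡ : ∀ c xs → foldr _∙_ ε (map (c ∙_) xs) ≡ (length xs · c) ∙ foldr _∙_ ε xs
  foldr-map-∙ˡ c []       = sym (CommutativeMonoid.identityˡ monoid ε)
  foldr-map-∙ˡ c (x ∷ xs) = begin
    (c ∙ x) ∙ foldr _∙_ ε (map (c ∙_) xs)       ≡⟨ cong ((c ∙ x) ∙_) (foldr-map-∙ˡ c xs) ⟩
    (c ∙ x) ∙ ((length xs · c) ∙ foldr _∙_ ε xs) ≡⟨ interchange c x (length xs · c) _ ⟩
    (c ∙ (length xs · c)) ∙ (x ∙ foldr _∙_ ε xs) ∎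
    where open ≡-Reasoning

  foldr-translate : ∀ c {xs} → Unique xs → (∀ y z → c ∙ y ≡ c ∙ z → y ≡ z) →
                    (∀ {x} → x ∈ xs → c ∙ x ∈ xs) → (length xs · c) ∙ foldr _∙_ ε xs ≡ foldr _∙_ ε xs
  foldr-translate c {xs} unique cancel closed = begin
    (length xs · c) ∙ foldr _∙_ ε xs ≡⟨ sym (foldr-map-∙ˡ c xs) ⟩
    foldr _∙_ ε (map (c ∙_) xs)      ≡⟨ foldr-↭ c·xs↭xs ⟩
    foldr _∙_ ε xs                   ∎
    where
    open ≡-Reasoning
    foldr-↭ = ↭ₛ.foldr-commMonoid (setoid A) isCommutativeMonoid ∘ ↭⇒↭ₛ
    c·xs⊆xs : map (c ∙_) xs ⊆ xs
    c·xs⊆xs y∈c·xs with ∈-map⁻ (c ∙_) y∈c·xs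
    ... | x , x∈xs , refl = closed x∈xs
    c·xs↭xs : map (c ∙_) xs ↭ xs
    c·xs↭xs = ⊆-Unique-length⇒↭ (Unique.map⁺ (cancel _ _) unique) c·xs⊆xs (length-map (c ∙_) xs)

prime∣m!⇒p≤m : ∀ {p} m → Prime p → p ∣ m ! → p ℕ.≤ m
prime∣m!⇒p≤m {p} zero    p-prime p∣1 =
  ⊥-elim (ℕ.<⇒≢ (ℕ.nonTrivial⇒n>1 p {{prime⇒nonTrivial p-prime}}) (sym (∣1⇒≡1 p∣1)))
prime∣m!⇒p≤m     (suc m) p-prime p∣m! with euclidsLemma (suc m) (m !) p-prime p∣m!
... | inj₁ p∣1+m = ∣⇒≤ p∣1+m
... | inj₂ p∣m!  = ℕ.m≤n⇒m≤1+n (prime∣m!⇒p≤m m p-prime p∣m!)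

k![n∸k]!nCk≡n! : ∀ {n k} → k ℕ.≤ n → (k ! ℕ.* (n ∸ k) !) ℕ.* (n C k) ≡ n !
k![n∸k]!nCk≡n! {n} {k} k≤n =
  trans (cong (k ! ℕ.* (n ∸ k) ! ℕ.*_) (nCk≡n!/k![n-k]! k≤n)) (m*[n/m]≡n {{_}} (k![n∸k]!∣n! k≤n))

-- p divides k! (p ∸ k)! · (p C k) = p!, but neither factorial.
prime∣pCk : ∀ {p k} → Prime p → 0 ℕ.< k → k ℕ.< p → p ∣ p C k
prime∣pCk {p@(suc p-1)} {k} p-prime 0<k k<p
  with euclidsLemma (k ! ℕ.* (p ∸ k) !) (p C k) p-prime
                    (subst (p ∣_) (sym (k![n∸k]!nCk≡n! (ℕ.<⇒≤ k<p))) (m∣m*n (p-1 !)))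
... | inj₂ p∣pCk = p∣pCk
... | inj₁ p∣k![p-k]! with euclidsLemma (k !) ((p ∸ k) !) p-prime p∣k![p-k]!
...   | inj₁ p∣k!     = ⊥-elim (ℕ.<⇒≱ k<p (prime∣m!⇒p≤m k p-prime p∣k!))
...   | inj₂ p∣[p-k]! =
  ⊥-elim (ℕ.<⇒≱ (ℕ.∸-monoʳ-< 0<k (ℕ.<⇒≤ k<p)) (prime∣m!⇒p≤m (p ∸ k) p-prime p∣[p-k]!))

module FieldProperties (F : Field) where

  open Field F

  commutativeRing : CommutativeRing 0ℓ 0ℓ
  commutativeRing = record { isCommutativeRing = isCommutativeRing }

  open CommutativeRing commutativeRing public
    using ( _-_; ring; semiring; commutativeSemiring; +-isCommutativeMonoid; *-isCommutativeMonoid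
          ; +-assoc; +-comm; +-identityˡ; +-identityʳ
          ; *-assoc; *-comm; *-identityˡ; *-identityʳ; zeroˡ; zeroʳ )
  open import Algebra.Properties.Ring ring public using (+-cancelˡ; +-cancelʳ; x∙y⁻¹≈ε⇒x≈y; xyx⁻¹≈y)
  open import Algebra.Properties.Semiring.Exp semiring public using (_^_; ^-assocʳ)
  open import Algebra.Properties.CommutativeSemiring.Exp commutativeSemiring public using (^-distrib-*)
  open import Algebra.Properties.Semiring.Mult semiring public
    using (×-assoc-*; ×1-homo-*) renaming (_×_ to _·_)
  open import Algebra.Properties.Monoid.Sum (CommutativeSemiring.+-monoid commutativeSemiring)
    using (sum; sum-init-last; sum-cong-≗; sum-replicate-zero)
  import Algebra.Properties.CommutativeSemiring.Binomial commutativeSemiring as Binomial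
  open import Algebra.Properties.CommutativeSemigroup (CommutativeRing.*-commutativeSemigroup commutativeRing) public
    using (xy∙z≈x∙zy; x∙yz≈y∙xz) renaming (interchange to *-interchange)
  open import Algebra.Solver.Ring.NaturalCoefficients.Default commutativeSemiring public
    using (solve; _:=_; _:+_; _:*_)

  *-cancelˡ : ∀ x {y z} → x ≢ 0# → x * y ≡ x * z → y ≡ z
  *-cancelˡ x {y} {z} x≢0 xy≡xz = begin
    y             ≡⟨ cancel y ⟨
    x⁻¹ * (x * y) ≡⟨ cong (x⁻¹ *_) xy≡xz ⟩
    x⁻¹ * (x * z) ≡⟨ cancel z ⟩
    z             ∎
    where
    open ≡-Reasoning
    x⁻¹ = proj₁ (inverse x x≢0)
    cancel : ∀ w → x⁻¹ * (x * w) ≡ w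
    cancel w = trans (sym (*-assoc x⁻¹ x w))
                     (trans (cong (_* w) (trans (*-comm x⁻¹ x) (proj₂ (inverse x x≢0)))) (*-identityˡ w))

  *-nonzero : ∀ {x y} → x ≢ 0# → y ≢ 0# → x * y ≢ 0#
  *-nonzero {x} {y} x≢0 y≢0 xy≡0 = y≢0 (*-cancelˡ x x≢0 (trans xy≡0 (sym (zeroʳ x))))

  x*y≡1⇒y≢0 : ∀ {x y} → x * y ≡ 1# → y ≢ 0#
  x*y≡1⇒y≢0 {x} xy≡1 y≡0 = 0≢1 (trans (sym (zeroʳ x)) (trans (cong (x *_) (sym y≡0)) xy≡1))

  ^-nonzero : ∀ {x} n → x ≢ 0# → x ^ n ≢ 0#
  ^-nonzero zero    x≢0 1≡0 = 0≢1 (sym 1≡0)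
  ^-nonzero (suc n) x≢0     = *-nonzero x≢0 (^-nonzero n x≢0)

  y+[x-y]≡x : ∀ x y → y + (x - y) ≡ x
  y+[x-y]≡x x y = trans (sym (+-assoc y x (- y))) (xyx⁻¹≈y y x)

  ≢⇒≡+nonzero : ∀ {x y} → x ≢ y → ∃ λ s → s ≢ 0# × x ≡ y + s
  ≢⇒≡+nonzero {x} {y} x≢y = x - y , (λ x-y≡0 → x≢y (x∙y⁻¹≈ε⇒x≈y x y x-y≡0)) , sym (y+[x-y]≡x x y)

  quadratic : Carrier → Carrier → Carrier → Carrier → Carrier
  quadratic a b c x = a * x * x + b * x + c

  -- a (x + x + s) + b is the difference quotient of the quadratic between x and x + s.
  fixed-points⇒slope≡1 : ∀ a b c x {s} → s ≢ 0# →
                          quadratic a b c x ≡ x → quadratic a b c (x + s) ≡ x + s → a * (x + x + s) + b ≡ 1#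
  fixed-points⇒slope≡1 a b c x {s} s≢0 fx≡x fxs≡xs = *-cancelˡ s s≢0 (+-cancelʳ x _ _ (begin
    s * (a * (x + x + s) + b) + x                 ≡⟨ cong (s * (a * (x + x + s) + b) +_) fx≡x ⟨
    s * (a * (x + x + s) + b) + quadratic a b c x ≡⟨ expand a b c x s ⟨
    quadratic a b c (x + s)                        ≡⟨ fxs≡xs ⟩
    x + s                                          ≡⟨ +-comm x s ⟩
    s + x                                          ≡⟨ cong (_+ x) (*-identityʳ s) ⟨
    s * 1# + x                                     ∎))
    where
    open ≡-Reasoning
    expand : ∀ a b c x s → quadratic a b c (x + s) ≡ s * (a * (x + x + s) + b) + quadratic a b c x
    expand = solve 5 (λ a b c x s → a :* (x :+ s) :* (x :+ s) :+ b :* (x :+ s) :+ c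
                            := s :* (a :* (x :+ x :+ s) :+ b) :+ (a :* x :* x :+ b :* x :+ c)) refl

  three-fixed-points⇒a≡0 : ∀ a b c {h₁ h₂ h₃} → h₁ ≢ h₂ → h₁ ≢ h₃ → h₂ ≢ h₃ →
                            quadratic a b c h₁ ≡ h₁ → quadratic a b c h₂ ≡ h₂ → quadratic a b c h₃ ≡ h₃ →
                            a ≡ 0#
  three-fixed-points⇒a≡0 a b c {h₁} {h₂} {h₃} h₁≢h₂ h₁≢h₃ h₂≢h₃ f₁ f₂ f₃
    with ≢⇒≡+nonzero h₁≢h₂ | ≢⇒≡+nonzero (h₁≢h₃ ∘ sym)
  ... | s , s≢0 , refl | u , u≢0 , refl = *-cancelˡ u u≢0 (+-cancelʳ 1# _ _ (begin
    u * a + 1#                                 ≡⟨ cong (u * a +_) slope-s ⟨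
    u * a + (a * (h₂ + h₂ + s) + b)            ≡⟨ regroup a b h₂ s u ⟨
    a * (h₂ + h₂ + (s + u)) + b                ≡⟨ slope-s+u ⟩
    1#                                         ≡⟨ +-identityˡ 1# ⟨
    0# + 1#                                    ≡⟨ cong (_+ 1#) (zeroʳ u) ⟨
    u * 0# + 1#                                ∎))
    where
    open ≡-Reasoning
    regroup : ∀ a b x s u → a * (x + x + (s + u)) + b ≡ u * a + (a * (x + x + s) + b)
    regroup = solve 5 (λ a b x s u → a :* (x :+ x :+ (s :+ u)) :+ b := u :* a :+ (a :* (x :+ x :+ s) :+ b)) refl
    s+u≢0 : s + u ≢ 0#
    s+u≢0 s+u≡0 = h₂≢h₃ (sym (trans (+-assoc h₂ s u) (trans (cong (h₂ +_) s+u≡0) (+-identityʳ h₂))))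
    slope-s : a * (h₂ + h₂ + s) + b ≡ 1#
    slope-s = fixed-points⇒slope≡1 a b c h₂ s≢0 f₂ f₁
    slope-s+u : a * (h₂ + h₂ + (s + u)) + b ≡ 1#
    slope-s+u = fixed-points⇒slope≡1 a b c h₂ s+u≢0 f₂
                  (subst (λ x → quadratic a b c x ≡ x) (+-assoc h₂ s u) f₃)

  multiple·≡0 : ∀ {p n} → p · 1# ≡ 0# → p ∣ n → ∀ x → n · x ≡ 0#
  multiple·≡0 {p} p·1≡0 (divides c refl) x = begin
    (c ℕ.* p) · x               ≡⟨ cong ((c ℕ.* p) ·_) (*-identityˡ x) ⟨
    (c ℕ.* p) · (1# * x)        ≡⟨ ×-assoc-* (c ℕ.* p) 1# x ⟨
    (c ℕ.* p) · 1# * x          ≡⟨ cong (_* x) (×1-homo-* c p) ⟩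
    c · 1# * p · 1# * x         ≡⟨ cong (λ z → c · 1# * z * x) p·1≡0 ⟩
    c · 1# * 0# * x             ≡⟨ cong (_* x) (zeroʳ (c · 1#)) ⟩
    0# * x                      ≡⟨ zeroˡ x ⟩
    0#                          ∎
    where open ≡-Reasoning

  -- In the binomial expansion of (x + y)^p only the two outer terms survive, as p divides p C k for 0 < k < p.
  frobenius : ∀ {p} → Prime p → p · 1# ≡ 0# → ∀ x y → (x + y) ^ p ≡ x ^ p + y ^ p
  frobenius {p} p-prime p·1≡0 x y with ℕ.nonTrivial⇒n>1 p {{prime⇒nonTrivial p-prime}}
  frobenius {p@(suc (suc m))} p-prime p·1≡0 x y | s≤s (s≤s z≤n) = begin
    (x + y) ^ p                                           ≡⟨ Binomial.theorem p x y ⟩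
    term 0F + sum (term ∘ Fin.suc)
      ≡⟨ cong (term 0F +_) (sum-init-last (term ∘ Fin.suc)) ⟩
    term 0F + (sum (term ∘ Fin.suc ∘ inject₁) + term last)
      ≡⟨ cong₂ (λ s t → term 0F + (s + t)) inner≡0 last≡x^p ⟩
    term 0F + (0# + x ^ p)                                 ≡⟨ cong₂ _+_ first≡y^p (+-identityˡ (x ^ p)) ⟩
    y ^ p + x ^ p                                          ≡⟨ +-comm (y ^ p) (x ^ p) ⟩
    x ^ p + y ^ p                                          ∎
    where
    open ≡-Reasoning
    term = Binomial.binomialTerm x y p
    last = Fin.suc (fromℕ (suc m))
    first≡y^p : term 0F ≡ y ^ p
    first≡y^p = trans (+-identityʳ _) (*-identityˡ _)
    last≡x^p : term last ≡ x ^ p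
    last≡x^p rewrite toℕ-fromℕ m | nCn≡1 p | ℕ.n∸n≡0 p = trans (+-identityʳ _) (*-identityʳ _)
    inner≡0 : sum (term ∘ Fin.suc ∘ inject₁) ≡ 0#
    inner≡0 = trans (sum-cong-≗ vanishes) (sum-replicate-zero (suc m))
      where
      vanishes : ∀ j → term (Fin.suc (inject₁ j)) ≡ 0#
      vanishes j = multiple·≡0 p·1≡0 (prime∣pCk p-prime (s≤s z≤n) (s≤s (s≤s j<m))) _
        where
        j<m : toℕ (inject₁ j) ℕ.≤ m
        j<m = subst (ℕ._≤ m) (sym (toℕ-inject₁ j)) (ℕ.≤-pred (toℕ<n j))

  frobenius-^ : ∀ {p} → Prime p → p · 1# ≡ 0# →
                ∀ k x y → (x + y) ^ (p ℕ.^ k) ≡ x ^ (p ℕ.^ k) + y ^ (p ℕ.^ k)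
  frobenius-^ {p} p-prime p·1≡0 zero    x y =
    trans (*-identityʳ _) (sym (cong₂ _+_ (*-identityʳ x) (*-identityʳ y)))
  frobenius-^ {p} p-prime p·1≡0 (suc k) x y = begin
    (x + y) ^ (p ℕ.* p ℕ.^ k)                 ≡⟨ ^-assocʳ (x + y) p (p ℕ.^ k) ⟨
    ((x + y) ^ p) ^ (p ℕ.^ k)                 ≡⟨ cong (_^ (p ℕ.^ k)) (frobenius p-prime p·1≡0 x y) ⟩
    (x ^ p + y ^ p) ^ (p ℕ.^ k)               ≡⟨ frobenius-^ p-prime p·1≡0 k (x ^ p) (y ^ p) ⟩
    (x ^ p) ^ (p ℕ.^ k) + (y ^ p) ^ (p ℕ.^ k) ≡⟨ cong₂ _+_ (^-assocʳ x p (p ℕ.^ k)) (^-assocʳ y p (p ℕ.^ k)) ⟩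
    x ^ (p ℕ.* p ℕ.^ k) + y ^ (p ℕ.* p ℕ.^ k) ∎
    where open ≡-Reasoning

  ·1-homo-^ : ∀ p k → (p ℕ.^ k) · 1# ≡ (p · 1#) ^ k
  ·1-homo-^ p zero    = +-identityʳ 1#
  ·1-homo-^ p (suc k) = trans (×1-homo-* p (p ℕ.^ k)) (cong ((p · 1#) *_) (·1-homo-^ p k))

  ^≡0⇒≡0 : ∀ {x} n → Dec (x ≡ 0#) → x ^ n ≡ 0# → x ≡ 0#
  ^≡0⇒≡0 n (yes x≡0) _     = x≡0
  ^≡0⇒≡0 n (no x≢0)  x^n≡0 = ⊥-elim (^-nonzero n x≢0 x^n≡0)

  module _ {N} (Carrier↔Fin : Carrier ↔ Fin N) where

    open Inverse Carrier↔Fin using (to; from; strictlyInverseˡ; strictlyInverseʳ)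

    N·x≡0 : ∀ x → N · x ≡ 0#
    N·x≡0 x = +-cancelʳ (sum′ elements) (N · x) 0# (begin
      N · x + sum′ elements                ≡⟨ cong (λ n → n · x + sum′ elements) length-elements ⟨
      length elements · x + sum′ elements  ≡⟨ foldr-translate +-isCommutativeMonoid x unique-elements
                                                (+-cancelˡ x) (λ _ → all-elements _) ⟩
      sum′ elements                        ≡⟨ +-identityˡ _ ⟨
      0# + sum′ elements                   ∎)
      where
      open ≡-Reasoning
      sum′ : List Carrier → Carrier
      sum′ = foldr _+_ 0#
      elements : List Carrier
      elements = map from (allFin N)
      from-injective : ∀ {i j} → from i ≡ from j → i ≡ j
      from-injective {i} {j} fi≡fj = trans (sym (strictlyInverseˡ i)) (trans (cong to fi≡fj) (strictlyInverseˡ j))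
      unique-elements : Unique elements
      unique-elements = Unique.map⁺ from-injective (Unique.allFin⁺ N)
      all-elements : ∀ x → x ∈ elements
      all-elements x = subst (_∈ elements) (strictlyInverseʳ x) (∈-map⁺ from (∈-allFin (to x)))
      length-elements : length elements ≡ N
      length-elements = trans (length-map from (allFin N)) (length-tabulate (λ i → i))

  product : List Carrier → Carrier
  product = foldr _*_ 1#

  product-nonzero : ∀ xs → (∀ {x} → x ∈ xs → x ≢ 0#) → product xs ≢ 0#
  product-nonzero []       _       1≡0 = 0≢1 (sym 1≡0)
  product-nonzero (x ∷ xs) nonzero = *-nonzero (nonzero (here refl)) (product-nonzero xs (nonzero ∘ there))

  module _ {H : Carrier → Set} {t} (H-subgroup : IsMulSubgroupOfOrder F H t) where

    open IsMulSubgroupOfOrder H-subgroup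

    member⇒H : ∀ {x} → x ∈ elements → H x
    member⇒H {x} = Equivalence.from (elemsSpec x)

    h^t≡1 : ∀ {h} → H h → h ^ t ≡ 1#
    h^t≡1 {h} h∈H = *-cancelˡ (product elements) product≢0 (begin
      product elements * h ^ t                 ≡⟨ *-comm _ _ ⟩
      h ^ t * product elements                 ≡⟨ cong (λ n → h ^ n * product elements) elemsLength ⟨
      h ^ length elements * product elements   ≡⟨ foldr-translate *-isCommutativeMonoid h elemsUnique
                                                    (λ _ _ → *-cancelˡ h (nonzero h h∈H)) closed ⟩
      product elements                         ≡⟨ *-identityʳ _ ⟨
      product elements * 1#                    ∎)
      where
      open ≡-Reasoning
      product≢0 : product elements ≢ 0#
      product≢0 = product-nonzero elements (λ {x} → nonzero x ∘ member⇒H)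
      closed : ∀ {x} → x ∈ elements → h * x ∈ elements
      closed {x} = Equivalence.to (elemsSpec (h * x)) ∘ mul∈ h x h∈H ∘ member⇒H

module Plane (F : Field) where

  open Field F
  open FieldProperties F

  Point : Set
  Point = Carrier × Carrier

  infix 7 _∙_
  _∙_ : Point → Point → Carrier
  (a₁ , a₂) ∙ (x , y) = a₁ * x + a₂ * y

  infixr 8 _⊛_
  _⊛_ : Carrier → Point → Point
  c ⊛ (x , y) = c * x , c * y

  Proportional : Point → Point → Set
  Proportional (x , y) (x′ , y′) = x * y′ ≡ x′ * y

  det : Point → Point → Carrier
  det (x , y) (x′ , y′) = x * y′ - x′ * y

  ¬proportional⇒det≢0 : ∀ {b b′} → ¬ Proportional b b′ → det b b′ ≢ 0#
  ¬proportional⇒det≢0 {x , y} {x′ , y′} ¬prop det≡0 = ¬prop (x∙y⁻¹≈ε⇒x≈y _ _ det≡0)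

  -- The negation-free form of cramer below, so that the commutative-semiring solver applies.
  cramer′ : ∀ a₁ a₂ x₁ y₁ x₂ y₂ x₃ y₃ D α β →
            x₁ * y₂ ≡ x₂ * y₁ + D → x₃ * y₂ ≡ x₂ * y₃ + α → x₁ * y₃ ≡ x₃ * y₁ + β →
            D * (a₁ * x₃ + a₂ * y₃) ≡ α * (a₁ * x₁ + a₂ * y₁) + β * (a₁ * x₂ + a₂ * y₂)
  cramer′ a₁ a₂ x₁ y₁ x₂ y₂ x₃ y₃ D α β eD eα eβ = +-cancelʳ K _ _ (begin
    D * w + K                                       ≡⟨ regroupˡ D w (x₂ * y₁) (x₂ * y₃ * u + x₃ * y₁ * v) ⟩
    (x₂ * y₁ + D) * w + (x₂ * y₃ * u + x₃ * y₁ * v) ≡⟨ cong (λ z → z * w + (x₂ * y₃ * u + x₃ * y₁ * v)) eD ⟨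
    x₁ * y₂ * w + (x₂ * y₃ * u + x₃ * y₁ * v)       ≡⟨ expand a₁ a₂ x₁ y₁ x₂ y₂ x₃ y₃ ⟩
    x₂ * y₁ * w + (x₃ * y₂ * u + x₁ * y₃ * v)       ≡⟨ cong₂ (λ z z′ → x₂ * y₁ * w + (z * u + z′ * v)) eα eβ ⟩
    x₂ * y₁ * w + ((x₂ * y₃ + α) * u + (x₃ * y₁ + β) * v)
                                                    ≡⟨ regroupʳ α β u v (x₂ * y₁ * w) (x₂ * y₃) (x₃ * y₁) ⟨
    α * u + β * v + K                               ∎)
    where
    open ≡-Reasoning
    u = a₁ * x₁ + a₂ * y₁
    v = a₁ * x₂ + a₂ * y₂
    w = a₁ * x₃ + a₂ * y₃
    K = x₂ * y₁ * w + (x₂ * y₃ * u + x₃ * y₁ * v)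
    regroupˡ : ∀ D w p q → D * w + (p * w + q) ≡ (p + D) * w + q
    regroupˡ = solve 4 (λ D w p q → D :* w :+ (p :* w :+ q) := (p :+ D) :* w :+ q) refl
    regroupʳ : ∀ α β u v p₁ p₂ p₃ →
               α * u + β * v + (p₁ + (p₂ * u + p₃ * v)) ≡ p₁ + ((p₂ + α) * u + (p₃ + β) * v)
    regroupʳ = solve 7 (λ α β u v p₁ p₂ p₃ → α :* u :+ β :* v :+ (p₁ :+ (p₂ :* u :+ p₃ :* v))
                              := p₁ :+ ((p₂ :+ α) :* u :+ (p₃ :+ β) :* v)) refl
    expand : ∀ a₁ a₂ x₁ y₁ x₂ y₂ x₃ y₃ →
             x₁ * y₂ * (a₁ * x₃ + a₂ * y₃)
               + (x₂ * y₃ * (a₁ * x₁ + a₂ * y₁) + x₃ * y₁ * (a₁ * x₂ + a₂ * y₂)) ≡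
             x₂ * y₁ * (a₁ * x₃ + a₂ * y₃)
               + (x₃ * y₂ * (a₁ * x₁ + a₂ * y₁) + x₁ * y₃ * (a₁ * x₂ + a₂ * y₂))
    expand = solve 8 (λ a₁ a₂ x₁ y₁ x₂ y₂ x₃ y₃ →
      x₁ :* y₂ :* (a₁ :* x₃ :+ a₂ :* y₃)
        :+ (x₂ :* y₃ :* (a₁ :* x₁ :+ a₂ :* y₁) :+ x₃ :* y₁ :* (a₁ :* x₂ :+ a₂ :* y₂)) :=
      x₂ :* y₁ :* (a₁ :* x₃ :+ a₂ :* y₃)
        :+ (x₃ :* y₂ :* (a₁ :* x₁ :+ a₂ :* y₁) :+ x₁ :* y₃ :* (a₁ :* x₂ :+ a₂ :* y₂))) refl

  cramer : ∀ a b₁ b₂ b₃ → det b₁ b₂ * (a ∙ b₃) ≡ det b₃ b₂ * (a ∙ b₁) + det b₁ b₃ * (a ∙ b₂)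
  cramer (a₁ , a₂) (x₁ , y₁) (x₂ , y₂) (x₃ , y₃) =
    cramer′ a₁ a₂ x₁ y₁ x₂ y₂ x₃ y₃ _ _ _
            (det-spec x₁ y₂ x₂ y₁) (det-spec x₃ y₂ x₂ y₃) (det-spec x₁ y₃ x₃ y₁)
    where
    det-spec : ∀ a b c d → a * b ≡ c * d + (a * b - c * d)
    det-spec a b c d = sym (y+[x-y]≡x (a * b) (c * d))

  ∙-injective : ∀ {a c b₁ b₂} → ¬ Proportional b₁ b₂ → a ∙ b₁ ≡ c ∙ b₁ → a ∙ b₂ ≡ c ∙ b₂ → a ≡ c
  ∙-injective {a₁ , a₂} {c₁ , c₂} {b₁} {b₂} ¬prop ab₁≡cb₁ ab₂≡cb₂ =
    cong₂ _,_ (agree-on (1# , 0#) (coordinate₁ a₁ a₂) (coordinate₁ c₁ c₂))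
              (agree-on (0# , 1#) (coordinate₂ a₁ a₂) (coordinate₂ c₁ c₂))
    where
    open ≡-Reasoning
    agree-on : ∀ e {x z} → (a₁ , a₂) ∙ e ≡ x → (c₁ , c₂) ∙ e ≡ z → x ≡ z
    agree-on e refl refl = *-cancelˡ (det b₁ b₂) (¬proportional⇒det≢0 ¬prop) (begin
      det b₁ b₂ * ((a₁ , a₂) ∙ e)                                   ≡⟨ cramer (a₁ , a₂) b₁ b₂ e ⟩
      det e b₂ * ((a₁ , a₂) ∙ b₁) + det b₁ e * ((a₁ , a₂) ∙ b₂)
                                          ≡⟨ cong₂ (λ s t → det e b₂ * s + det b₁ e * t) ab₁≡cb₁ ab₂≡cb₂ ⟩
      det e b₂ * ((c₁ , c₂) ∙ b₁) + det b₁ e * ((c₁ , c₂) ∙ b₂)     ≡⟨ cramer (c₁ , c₂) b₁ b₂ e ⟨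
      det b₁ b₂ * ((c₁ , c₂) ∙ e)                                   ∎)
    coordinate₁ : ∀ x y → (x , y) ∙ (1# , 0#) ≡ x
    coordinate₁ x y = trans (cong₂ _+_ (*-identityʳ x) (zeroʳ y)) (+-identityʳ x)
    coordinate₂ : ∀ x y → (x , y) ∙ (0# , 1#) ≡ y
    coordinate₂ x y = trans (cong₂ _+_ (zeroʳ x) (*-identityʳ y)) (+-identityˡ y)

  ⊛-∙ : ∀ λ′ p q → (λ′ ⊛ p) ∙ q ≡ λ′ * (p ∙ q)
  ⊛-∙ λ′ (x , y) (x′ , y′) =
    solve 5 (λ λ′ x y x′ y′ → λ′ :* x :* x′ :+ λ′ :* y :* y′ := λ′ :* (x :* x′ :+ y :* y′)) refl λ′ x y x′ y′

  proportional⇒scaled : ∀ a {b b′ u} → u * (a ∙ b) ≡ 1# → Proportional b b′ → b′ ≡ (u * (a ∙ b′)) ⊛ b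
  proportional⇒scaled (a₁ , a₂) {x , y} {x′ , y′} {u} u[a∙b]≡1 xy′≡x′y =
    cong₂ _,_
      (rescale (begin
        (a₁ * x + a₂ * y) * x′        ≡⟨ expand₁ a₁ a₂ x y x′ ⟩
        a₁ * (x * x′) + a₂ * (x′ * y) ≡⟨ cong (λ z → a₁ * (x * x′) + a₂ * z) xy′≡x′y ⟨
        a₁ * (x * x′) + a₂ * (x * y′) ≡⟨ collect₁ a₁ a₂ x x′ y′ ⟩
        (a₁ * x′ + a₂ * y′) * x       ∎))
      (rescale (begin
        (a₁ * x + a₂ * y) * y′        ≡⟨ expand₂ a₁ a₂ x y y′ ⟩
        a₁ * (x * y′) + a₂ * (y * y′) ≡⟨ cong (λ z → a₁ * z + a₂ * (y * y′)) xy′≡x′y ⟩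
        a₁ * (x′ * y) + a₂ * (y * y′) ≡⟨ collect₂ a₁ a₂ x′ y y′ ⟩
        (a₁ * x′ + a₂ * y′) * y       ∎))
    where
    open ≡-Reasoning
    expand₁ : ∀ a₁ a₂ x y x′ → (a₁ * x + a₂ * y) * x′ ≡ a₁ * (x * x′) + a₂ * (x′ * y)
    expand₁ = solve 5 (λ a₁ a₂ x y x′ → (a₁ :* x :+ a₂ :* y) :* x′
                                        := a₁ :* (x :* x′) :+ a₂ :* (x′ :* y)) refl
    collect₁ : ∀ a₁ a₂ x x′ y′ → a₁ * (x * x′) + a₂ * (x * y′) ≡ (a₁ * x′ + a₂ * y′) * x
    collect₁ = solve 5 (λ a₁ a₂ x x′ y′ → a₁ :* (x :* x′) :+ a₂ :* (x :* y′)
                                          := (a₁ :* x′ :+ a₂ :* y′) :* x) refl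
    expand₂ : ∀ a₁ a₂ x y y′ → (a₁ * x + a₂ * y) * y′ ≡ a₁ * (x * y′) + a₂ * (y * y′)
    expand₂ = solve 5 (λ a₁ a₂ x y y′ → (a₁ :* x :+ a₂ :* y) :* y′
                                        := a₁ :* (x :* y′) :+ a₂ :* (y :* y′)) refl
    collect₂ : ∀ a₁ a₂ x′ y y′ → a₁ * (x′ * y) + a₂ * (y * y′) ≡ (a₁ * x′ + a₂ * y′) * y
    collect₂ = solve 5 (λ a₁ a₂ x′ y y′ → a₁ :* (x′ :* y) :+ a₂ :* (y :* y′)
                                          := (a₁ :* x′ :+ a₂ :* y′) :* y) refl
    rescale : ∀ {s z z′} → (a₁ * x + a₂ * y) * z ≡ s * z′ → z ≡ (u * s) * z′
    rescale {s} {z} {z′} eq = begin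
      z                               ≡⟨ *-identityˡ z ⟨
      1# * z                          ≡⟨ cong (_* z) u[a∙b]≡1 ⟨
      u * (a₁ * x + a₂ * y) * z       ≡⟨ *-assoc u _ z ⟩
      u * ((a₁ * x + a₂ * y) * z)     ≡⟨ cong (u *_) eq ⟩
      u * (s * z′)                    ≡⟨ *-assoc u s z′ ⟨
      u * s * z′                      ∎

module NormOne (F : Field) where

  open Field F
  open FieldProperties F

  record IsNormOneConjugation (H : Carrier → Set) (σ : Carrier → Carrier) : Set where
    field
      +-homo  : ∀ x y → σ (x + y) ≡ σ x + σ y
      *-homo  : ∀ x y → σ (x * y) ≡ σ x * σ y
      nonzero : ∀ {x} → x ≢ 0# → σ x ≢ 0#
      norm≡1  : ∀ {h} → H h → h * σ h ≡ 1#

  module _ {H σ} (conj : IsNormOneConjugation H σ) where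

    open IsNormOneConjugation conj

    norm-equation : ∀ c d {h} → H h → H (c + d * h) → quadratic (d * σ c) (c * σ c + d * σ d) (c * σ d) h ≡ h
    norm-equation c d {h} h∈H c+dh∈H = begin
      quadratic (d * σ c) (c * σ c + d * σ d) (c * σ d) h ≡⟨ factor c d h (σ c) (σ d) ⟩
      (c + d * h) * (σ c * h + σ d)                       ≡⟨ cong ((c + d * h) *_) conj-line ⟨
      (c + d * h) * (σ (c + d * h) * h)                   ≡⟨ *-assoc (c + d * h) _ h ⟨
      (c + d * h) * σ (c + d * h) * h                     ≡⟨ cong (_* h) (norm≡1 c+dh∈H) ⟩
      1# * h                                              ≡⟨ *-identityˡ h ⟩
      h                                                   ∎
      where
      open ≡-Reasoning
      factor : ∀ c d h c′ d′ → quadratic (d * c′) (c * c′ + d * d′) (c * d′) h ≡ (c + d * h) * (c′ * h + d′)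
      factor = solve 5 (λ c d h c′ d′ → d :* c′ :* h :* h :+ (c :* c′ :+ d :* d′) :* h :+ c :* d′
                                  := (c :+ d :* h) :* (c′ :* h :+ d′)) refl
      conj-line : σ (c + d * h) * h ≡ σ c * h + σ d
      conj-line = begin
        σ (c + d * h) * h              ≡⟨ cong (_* h) (trans (+-homo c (d * h)) (cong (σ c +_) (*-homo d h))) ⟩
        (σ c + σ d * σ h) * h          ≡⟨ distrib (σ c) (σ d) (σ h) h ⟩
        σ c * h + σ d * (h * σ h)      ≡⟨ cong (λ z → σ c * h + σ d * z) (norm≡1 h∈H) ⟩
        σ c * h + σ d * 1#             ≡⟨ cong (σ c * h +_) (*-identityʳ (σ d)) ⟩
        σ c * h + σ d                  ∎
        where
        distrib : ∀ c′ d′ h′ h → (c′ + d′ * h′) * h ≡ c′ * h + d′ * (h * h′)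
        distrib = solve 4 (λ c′ d′ h′ h → (c′ :+ d′ :* h′) :* h := c′ :* h :+ d′ :* (h :* h′)) refl

    line-meets-H-at-most-twice : ∀ {c d h₁ h₂ h₃} → c ≢ 0# → d ≢ 0# → H h₁ → H h₂ → H h₃ →
                                 h₁ ≢ h₂ → h₁ ≢ h₃ → h₂ ≢ h₃ →
                                 H (c + d * h₁) → H (c + d * h₂) → H (c + d * h₃) → ⊥
    line-meets-H-at-most-twice {c} {d} c≢0 d≢0 h₁∈H h₂∈H h₃∈H h₁≢h₂ h₁≢h₃ h₂≢h₃ k₁∈H k₂∈H k₃∈H =
      *-nonzero d≢0 (nonzero c≢0)
        (three-fixed-points⇒a≡0 _ _ _ h₁≢h₂ h₁≢h₃ h₂≢h₃
          (norm-equation c d h₁∈H k₁∈H) (norm-equation c d h₂∈H k₂∈H) (norm-equation c d h₃∈H k₃∈H))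

  frobenius-isNormOneConjugation : ∀ {q} → IsPrimePower q → Carrier ↔ Fin (q ℕ.* q) →
                                   ∀ {H} → IsMulSubgroupOfOrder F H (suc q) → IsNormOneConjugation H (_^ q)
  frobenius-isNormOneConjugation (p , k , p-prime , _ , refl) Carrier↔Fin H-subgroup = record
    { +-homo  = frobenius-^ p-prime p·1≡0 k
    ; *-homo  = λ x y → ^-distrib-* x y (p ℕ.^ k)
    ; nonzero = ^-nonzero (p ℕ.^ k)
    ; norm≡1  = h^t≡1 H-subgroup
    }
    where
    open ≡-Reasoning
    p·1≡0 : p · 1# ≡ 0#
    p·1≡0 = ^≡0⇒≡0 (k ℕ.+ k) (inj⇒≟ (↔⇒↣ Carrier↔Fin) (p · 1#) 0#) (begin
      (p · 1#) ^ (k ℕ.+ k)           ≡⟨ ·1-homo-^ p (k ℕ.+ k) ⟨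
      (p ℕ.^ (k ℕ.+ k)) · 1#         ≡⟨ cong (_· 1#) (ℕ.^-distribˡ-+-* p k k) ⟩
      (p ℕ.^ k ℕ.* p ℕ.^ k) · 1#     ≡⟨ N·x≡0 Carrier↔Fin 1# ⟩
      0#                             ∎)

module K33 (F : Field) {H : Field.Carrier F → Set} {t} (H-subgroup : IsMulSubgroupOfOrder F H t)
           {σ} (conj : NormOne.IsNormOneConjugation F H σ) where

  open Field F
  open FieldProperties F
  open Plane F
  open NormOne F
  open IsMulSubgroupOfOrder H-subgroup
  open Graph F H

  point : Vertex F → Point
  point = proj₁

  scaled⇒∼ : ∀ v w {h} → H h → point v ≡ h ⊛ point w → v ∼ w
  scaled⇒∼ v w {h} h∈H v≡hw = h , h∈H , cong proj₁ v≡hw , cong proj₂ v≡hw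

  proportional-neighbours⇒∼ : ∀ v w w′ → H (point v ∙ point w) → H (point v ∙ point w′) →
                              Proportional (point w) (point w′) → w′ ∼ w
  proportional-neighbours⇒∼ v w w′ vw∈H vw′∈H prop with inv∈ _ vw∈H
  ... | u , u∈H , vw*u≡1 =
    scaled⇒∼ w′ w (mul∈ u _ u∈H vw′∈H) (proportional⇒scaled (point v) (trans (*-comm u _) vw*u≡1) prop)

  module _ (A B : Fin 3 → Vertex F)
           (A-distinct : ∀ i j → i ≢ j → ¬ (A i ∼ A j)) (B-distinct : ∀ i j → i ≢ j → ¬ (B i ∼ B j))
           (adjacent : ∀ i j → Adj (A i) (B j)) where

    a b : Fin 3 → Point
    a = point ∘ A
    b = point ∘ B

    a∙b∈H : ∀ i j → H (a i ∙ b j)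
    a∙b∈H i j = proj₂ (adjacent i j)

    b-nonproportional : ∀ {j j′} → j ≢ j′ → ¬ Proportional (b j) (b j′)
    b-nonproportional j≢j′ prop =
      B-distinct _ _ (j≢j′ ∘ sym)
        (proportional-neighbours⇒∼ (A 0F) (B _) (B _) (a∙b∈H 0F _) (a∙b∈H 0F _) prop)

    u u⁻¹ h k : Fin 3 → Carrier
    u i   = a i ∙ b 0F
    u⁻¹ i = proj₁ (inv∈ (u i) (a∙b∈H i 0F))
    h i   = (a i ∙ b 1F) * u⁻¹ i
    k i   = (a i ∙ b 2F) * u⁻¹ i

    u⁻¹∈H : ∀ i → H (u⁻¹ i)
    u⁻¹∈H i = proj₁ (proj₂ (inv∈ (u i) (a∙b∈H i 0F)))

    u*u⁻¹≡1 : ∀ i → u i * u⁻¹ i ≡ 1#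
    u*u⁻¹≡1 i = proj₂ (proj₂ (inv∈ (u i) (a∙b∈H i 0F)))

    h∈H : ∀ i → H (h i)
    h∈H i = mul∈ _ _ (a∙b∈H i 1F) (u⁻¹∈H i)
    k∈H : ∀ i → H (k i)
    k∈H i = mul∈ _ _ (a∙b∈H i 2F) (u⁻¹∈H i)

    det-b≢0 : ∀ {j j′} → j ≢ j′ → det (b j) (b j′) ≢ 0#
    det-b≢0 = ¬proportional⇒det≢0 ∘ b-nonproportional

    D D⁻¹ c d : Carrier
    D   = det (b 0F) (b 1F)
    D⁻¹ = proj₁ (inverse D (det-b≢0 (λ ())))
    c   = det (b 2F) (b 1F) * D⁻¹
    d   = det (b 0F) (b 2F) * D⁻¹

    D*D⁻¹≡1 : D * D⁻¹ ≡ 1#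
    D*D⁻¹≡1 = proj₂ (inverse D (det-b≢0 (λ ())))

    c≢0 : c ≢ 0#
    c≢0 = *-nonzero (det-b≢0 (λ ())) (x*y≡1⇒y≢0 D*D⁻¹≡1)

    d≢0 : d ≢ 0#
    d≢0 = *-nonzero (det-b≢0 (λ ())) (x*y≡1⇒y≢0 D*D⁻¹≡1)

    k≡c+d*h : ∀ i → k i ≡ c + d * h i
    k≡c+d*h i = divide D*D⁻¹≡1 (u*u⁻¹≡1 i) (cramer (a i) (b 0F) (b 1F) (b 2F))
      where
      divide : ∀ {D D⁻¹ u u⁻¹ α β v w} → D * D⁻¹ ≡ 1# → u * u⁻¹ ≡ 1# → D * w ≡ α * u + β * v →
               w * u⁻¹ ≡ α * D⁻¹ + β * D⁻¹ * (v * u⁻¹)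
      divide {D} {D⁻¹} {u} {u⁻¹} {α} {β} {v} {w} D*D⁻¹≡1 u*u⁻¹≡1 Dw≡αu+βv = begin
        w * u⁻¹                                   ≡⟨ *-identityˡ _ ⟨
        1# * (w * u⁻¹)                            ≡⟨ cong (_* (w * u⁻¹)) D*D⁻¹≡1 ⟨
        D * D⁻¹ * (w * u⁻¹)                       ≡⟨ *-interchange D D⁻¹ w u⁻¹ ⟩
        D * w * (D⁻¹ * u⁻¹)                       ≡⟨ cong (_* (D⁻¹ * u⁻¹)) Dw≡αu+βv ⟩
        (α * u + β * v) * (D⁻¹ * u⁻¹)             ≡⟨ distribute α β u v D⁻¹ u⁻¹ ⟩
        α * D⁻¹ * (u * u⁻¹) + β * D⁻¹ * (v * u⁻¹) ≡⟨ cong (λ z → α * D⁻¹ * z + _) u*u⁻¹≡1 ⟩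
        α * D⁻¹ * 1# + β * D⁻¹ * (v * u⁻¹)        ≡⟨ cong (_+ β * D⁻¹ * (v * u⁻¹)) (*-identityʳ _) ⟩
        α * D⁻¹ + β * D⁻¹ * (v * u⁻¹)             ∎
        where
        open ≡-Reasoning
        distribute : ∀ α β u v x y → (α * u + β * v) * (x * y) ≡ α * x * (u * y) + β * x * (v * y)
        distribute = solve 6 (λ α β u v x y → (α :* u :+ β :* v) :* (x :* y)
                                            := α :* x :* (u :* y) :+ β :* x :* (v :* y)) refl

    h-injective : ∀ {i j} → h i ≡ h j → A i ∼ A j
    h-injective {i} {j} hi≡hj = scaled⇒∼ (A i) (A j) (mul∈ _ _ (a∙b∈H i 0F) (u⁻¹∈H j))
      (∙-injective (b-nonproportional (λ ())) (sym first-column) (sym second-column))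
      where
      open ≡-Reasoning
      λ′ = u i * u⁻¹ j
      first-column : (λ′ ⊛ a j) ∙ b 0F ≡ a i ∙ b 0F
      first-column = begin
        (λ′ ⊛ a j) ∙ b 0F          ≡⟨ ⊛-∙ λ′ (a j) (b 0F) ⟩
        u i * u⁻¹ j * u j          ≡⟨ xy∙z≈x∙zy (u i) (u⁻¹ j) (u j) ⟩
        u i * (u j * u⁻¹ j)        ≡⟨ cong (u i *_) (u*u⁻¹≡1 j) ⟩
        u i * 1#                   ≡⟨ *-identityʳ (u i) ⟩
        u i                        ∎
      second-column : (λ′ ⊛ a j) ∙ b 1F ≡ a i ∙ b 1F
      second-column = begin
        (λ′ ⊛ a j) ∙ b 1F          ≡⟨ ⊛-∙ λ′ (a j) (b 1F) ⟩
        u i * u⁻¹ j * (a j ∙ b 1F) ≡⟨ xy∙z≈x∙zy (u i) (u⁻¹ j) _ ⟩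
        u i * h j                  ≡⟨ cong (u i *_) hi≡hj ⟨
        u i * h i                  ≡⟨ x∙yz≈y∙xz (u i) _ (u⁻¹ i) ⟩
        (a i ∙ b 1F) * (u i * u⁻¹ i) ≡⟨ cong ((a i ∙ b 1F) *_) (u*u⁻¹≡1 i) ⟩
        (a i ∙ b 1F) * 1#          ≡⟨ *-identityʳ _ ⟩
        a i ∙ b 1F                 ∎

    h-distinct : ∀ i j → i ≢ j → h i ≢ h j
    h-distinct i j i≢j = A-distinct i j i≢j ∘ h-injective

    contradiction : ⊥
    contradiction = line-meets-H-at-most-twice conj c≢0 d≢0 (h∈H 0F) (h∈H 1F) (h∈H 2F)
      (h-distinct 0F 1F (λ ())) (h-distinct 0F 2F (λ ())) (h-distinct 1F 2F (λ ()))
      (subst H (k≡c+d*h 0F) (k∈H 0F)) (subst H (k≡c+d*h 1F) (k∈H 1F)) (subst H (k≡c+d*h 2F) (k∈H 2F))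

  K33-free : K33Free
  K33-free (A , B , A-distinct , B-distinct , adjacent) = contradiction A B A-distinct B-distinct adjacent

open import Data.Nat using (_*_)

theorem2 : (q : ℕ) → IsPrimePower q →
           (F : Field) → (Field.Carrier F ↔ Fin (q * q)) →
           (H : Field.Carrier F → Set) → IsMulSubgroupOfOrder F H (suc q) →
           Graph.K33Free F H
theorem2 q q-prime-power F F↔Fin H H-subgroup =
  K33.K33-free F H-subgroup (NormOne.frobenius-isNormOneConjugation F q-prime-power F↔Fin H-subgroup)
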